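{- For all positive integers $d$ and integers $n\geq0$, \[ C_n^{(d)}=P_n^{(d)}+P_{n-d}^{(d)}+P_{n-2d}^{(d)}+P_{n-3d}^{(d)}+\cdots . \]
   Context: $P_m^{(d)}$ denotes the number of partitions of the integer $m$ into at most $d$ parts (so $P_0^{(d)}=1$), and $P_m^{(d)}=0$ for $m<0$. $\Lambda_d=\mathbb{Z}_{\geq0}^d$ with basis $\mathbf{e}(1),\dots,\mathbf{e}(d)$; $X_d=\{\mathbf{e}(k)-\mathbf{e}(i)-\mathbf{e}(j): i,j,k\in\{1,\dots,d\},\ d\mid k-i-j\}$; for $\mathbf{v},\mathbf{w}\in\Lambda_d$, $\mathbf{v}\lessdot\mathbf{w}$ iff $\mathbf{v}-\mathbf{w}\in X_d$; $\prec$ is the transitive closure of $\lessdot$ on $\Lambda_d$ (chains staying in $\Lambda_d$). $C_n^{(d)}=|\{n\mathbf{e}(1)\}\cup\{\mathbf{w}\in\Lambda_d:\mathbf{w}\prec n\mathbf{e}(1)\}|$. -}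

module Defs where

open import Data.Nat using (ℕ; zero; suc; _+_; _*_; _∸_; _≤_; _≤ᵇ_; _≡ᵇ_)
open import Data.Bool using (if_then_else_)
open import Data.Fin using (Fin; toℕ; _≟_)
open import Data.Integer as ℤ using (ℤ; +_)
open import Data.Integer.Divisibility as ℤd using ()
open import Data.List using (List; length; map; upTo)
open import Data.Nat.ListAction using (sum)
open import Data.List.Relation.Unary.All using (All)
open import Data.List.Relation.Unary.Linked using (Linked)
open import Data.List.Relation.Unary.Unique.Propositional using (Unique)
open import Data.List.Membership.Propositional using (_∈_)
open import Data.Vec using (Vec; tabulate; zipWith)
open import Data.Product using (Σ; ∃; _×_)
open import Data.Sum using (_⊎_)
open import Function.Bundles using (_⇔_)
open import Relation.Nullary using (does)
open import Relation.Binary.PropositionalEquality using (_≡_)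
open import Relation.Binary.Construct.Closure.Transitive using (TransClosure)

HasCard : {A : Set} → (A → Set) → ℕ → Set
HasCard {A} P N = Σ (List A) λ xs → Unique xs × (∀ a → (a ∈ xs) ⇔ P a) × length xs ≡ N

IsPartition : ℕ → ℕ → List ℕ → Set
IsPartition d m λs = All (1 ≤_) λs × Linked (λ a b → b ≤ a) λs × sum λs ≡ m × length λs ≤ d

-- Λ_d = ℕ^d; coordinates indexed by Fin d, where Fin index t stands for t+1.
Λ : ℕ → Set
Λ d = Vec ℕ d

_⊕_ : ∀ {d} → Λ d → Λ d → Λ d
_⊕_ = zipWith _+_

e : ∀ {d} → Fin d → Λ d
e t = tabulate λ j → if does (j ≟ t) then 1 else 0

ne1 : (d n : ℕ) → Λ d
ne1 d n = tabulate λ (j : Fin d) → if toℕ j ≡ᵇ 0 then n else 0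

idx : ∀ {d} → Fin d → ℤ
idx t = + (suc (toℕ t))

-- v ⋖ w  iff  v - w = e(k) - e(i) - e(j) with d ∣ k - i - j
-- (stated in ℕ^d as v + e(i) + e(j) = w + e(k), equivalent to the ℤ^d equation)
Cov : (d : ℕ) → Λ d → Λ d → Set
Cov d v w = ∃ λ (i : Fin d) → ∃ λ (j : Fin d) → ∃ λ (k : Fin d) →
  ((+ d) ℤd.∣ ((idx k ℤ.- idx i) ℤ.- idx j)) × ((v ⊕ e i) ⊕ e j ≡ w ⊕ e k)

Prec : (d : ℕ) → Λ d → Λ d → Set
Prec d = TransClosure (Cov d)

InC : (d n : ℕ) → Λ d → Set
InC d n w = (w ≡ ne1 d n) ⊎ Prec d w (ne1 d n)

-- P_n + P_{n-d} + P_{n-2d} + ... , with P_m = 0 for m < 0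
-- (terms i = 0..n suffice since d ≥ 1; term i is zero when i*d > n)
partSum : (d n : ℕ) → (ℕ → ℕ) → ℕ
partSum d n P = sum (map (λ i → if i * d ≤ᵇ n then P (n ∸ i * d) else 0) (upTo (suc n)))

-- Grade Λ_d by the weight |w| = Σ_t t·w_t. A covering step v ⋖ w changes the
-- weight by |w| − |v| = i + j − k ∈ {0, d}, so everything below n e(1) has
-- weight n − a d. Conversely, e(t+1) ⋖ e(t) + e(1) and v ⋖ v + e(d) show that
-- every w of weight n − a d lies below n e(1). So C_n counts the vectors of
-- weight n, n − d, n − 2d, …, and the vectors of weight m are the multiplicity
-- vectors of partitions of m into parts of size at most d, which conjugation
-- matches with the partitions of m into at most d parts.
module Submission where

open import Defs

open import Data.Bool using (true; false; T; if_then_else_)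
open import Data.Empty using (⊥-elim)
open import Data.Fin as Fin using (Fin; toℕ; inject₁; fromℕ)
open import Data.Fin.Induction using (<-weakInduction)
open import Data.Fin.Properties using (toℕ-inject₁; toℕ-fromℕ; toℕ<n)
open import Data.Integer as ℤ using (_⊖_; ∣_∣)
import Data.Integer.Divisibility as ℤ
import Data.Integer.Properties as ℤ
open import Data.List using (List; []; _∷_; length; map; upTo; _++_)
open import Data.List.Membership.Propositional using (_∈_)
open import Data.List.Membership.Propositional.Properties
  using (∈-map⁺; ∈-map⁻; ∈-++⁺ˡ; ∈-++⁺ʳ; ∈-++⁻; ∈-upTo⁺)
open import Data.List.Properties using (length-map; length-++)
open import Data.List.Relation.Unary.All as All using (All; []; _∷_)
import Data.List.Relation.Unary.All.Properties as All
open import Data.List.Relation.Unary.Any using (here; there)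
open import Data.List.Relation.Unary.Linked as Linked using (Linked; []; [-]; _∷_)
open import Data.List.Relation.Unary.Unique.Propositional using (Unique; []; _∷_)
open import Data.List.Relation.Unary.Unique.Propositional.Properties using (++⁺; upTo⁺)
open import Data.Nat using (ℕ; _≤_; zero; suc; _+_; _*_; _∸_; _<_; _≤ᵇ_; z≤n; s≤s; z<s; NonZero; >-nonZero)
open import Data.Nat.Divisibility using (_∣_; divides; ∣-refl; _∣0; >⇒∤)
open import Data.Nat.ListAction using (sum)
open import Data.Nat.Properties
open import Algebra.Properties.CommutativeSemigroup +-commutativeSemigroup using (interchange)
open import Data.Product using (_×_; _,_; ∃; ∃₂; proj₂)
open import Data.Sum using (_⊎_; inj₁; inj₂)
open import Data.Unit using (tt)
open import Data.Vec as Vec using (Vec; []; _∷_; replicate; tabulate)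
open import Data.Vec.Properties using (zipWith-comm; zipWith-assoc; zipWith-identityʳ)
open import Function using (_∘_)
open import Function.Bundles using (_⇔_; mk⇔; Equivalence)
open import Function.Construct.Composition using (_⇔-∘_)
open import Function.Construct.Symmetry using (⇔-sym)
open import Relation.Binary.Construct.Closure.Transitive using ([_]; _∷_)
import Relation.Binary.Construct.Closure.Transitive as Plus
open import Relation.Binary.PropositionalEquality
open import Relation.Nullary using (¬_; yes; no)

open Equivalence using (to; from)
open ≡-Reasoning

-- Cardinalities

module _ {A : Set} where

  HasCard-cong : ∀ {P Q : A → Set} {N} → (∀ a → P a ⇔ Q a) → HasCard P N → HasCard Q N
  HasCard-cong P⇔Q (xs , unique , mem , len) = xs , unique , (λ a → P⇔Q a ⇔-∘ mem a) , len

  HasCard-∅ : ∀ {P : A → Set} → (∀ a → ¬ P a) → HasCard P 0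
  HasCard-∅ ¬P = [] , [] , (λ a → mk⇔ (λ ()) (⊥-elim ∘ ¬P a)) , refl

  map-unique : ∀ {B : Set} {G : A → Set} (f : A → B) → (∀ {x y} → G x → G y → f x ≡ f y → x ≡ y) →
    ∀ {xs} → All G xs → Unique xs → Unique (map f xs)
  map-unique f inj [] [] = []
  map-unique f inj (gx ∷ gxs) (x∉xs ∷ unique) =
    All.map⁺ (All.map (λ (gy , x≢y) fx≡fy → x≢y (inj gx gy fx≡fy)) (All.zip (gxs , x∉xs)))
      ∷ map-unique f inj gxs unique

  HasCard-bijection : ∀ {B : Set} {P : A → Set} {Q : B → Set} {N} (f : A → B) (g : B → A) →
    (∀ {a} → P a → Q (f a)) → (∀ {b} → Q b → P (g b)) →
    (∀ {a} → P a → g (f a) ≡ a) → (∀ {b} → Q b → f (g b) ≡ b) →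
    HasCard P N → HasCard Q N
  HasCard-bijection {P = P} {Q = Q} f g fP gQ gf fg (xs , unique , mem , len) =
    map f xs , map-unique f inj (All.tabulate (to (mem _))) unique , mem′ , trans (length-map f xs) len
    where
    inj : ∀ {x y} → P x → P y → f x ≡ f y → x ≡ y
    inj px py fx≡fy = trans (sym (gf px)) (trans (cong g fx≡fy) (gf py))
    mem′ : ∀ b → (b ∈ map f xs) ⇔ Q b
    mem′ b = mk⇔
      (λ b∈ → let a , a∈xs , b≡fa = ∈-map⁻ f b∈ in subst Q (sym b≡fa) (fP (to (mem a) a∈xs)))
      (λ qb → subst (_∈ map f xs) (fg qb) (∈-map⁺ f (from (mem (g b)) (gQ qb))))

  HasCard-⋃ : ∀ {I : Set} {Q : I → A → Set} {c : I → ℕ} → (∀ i → HasCard (Q i) (c i)) →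
    (∀ a {i j} → Q i a → Q j a → i ≡ j) →
    ∀ {is} → Unique is → HasCard (λ a → ∃ λ i → i ∈ is × Q i a) (sum (map c is))
  HasCard-⋃ card disjoint [] = HasCard-∅ λ { _ (_ , () , _) }
  HasCard-⋃ {Q = Q} card disjoint {i ∷ is} (i∉is ∷ unique)
    with card i | HasCard-⋃ card disjoint unique
  ... | xs , uxs , memxs , lenxs | ys , uys , memys , lenys =
    xs ++ ys , ++⁺ uxs uys apart , mem , trans (length-++ xs) (cong₂ _+_ lenxs lenys)
    where
    apart : ∀ {a} → ¬ (a ∈ xs × a ∈ ys)
    apart {a} (a∈xs , a∈ys) with to (memys a) a∈ys
    ... | j , j∈is , qj with disjoint a (to (memxs a) a∈xs) qj
    ... | refl = All.lookup i∉is j∈is refl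
    mem : ∀ a → (a ∈ xs ++ ys) ⇔ (∃ λ j → j ∈ i ∷ is × Q j a)
    mem a = mk⇔ index-of list-of
      where
      index-of : a ∈ xs ++ ys → ∃ λ j → j ∈ i ∷ is × Q j a
      index-of a∈ with ∈-++⁻ xs a∈
      ... | inj₁ a∈xs = i , here refl , to (memxs a) a∈xs
      ... | inj₂ a∈ys = let j , j∈is , qj = to (memys a) a∈ys in j , there j∈is , qj
      list-of : (∃ λ j → j ∈ i ∷ is × Q j a) → a ∈ xs ++ ys
      list-of (j , here refl , qj) = ∈-++⁺ˡ (from (memxs a) qj)
      list-of (j , there j∈is , qj) = ∈-++⁺ʳ xs (from (memys a) (j , j∈is , qj))

  HasCard-when : ∀ {m n} {Q : A → Set} {N} → HasCard Q N →
    HasCard (λ a → m ≤ n × Q a) (if m ≤ᵇ n then N else 0)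
  HasCard-when {m} {n} card with m ≤ᵇ n in m≤ᵇn
  ... | true = HasCard-cong (λ a → mk⇔ (≤ᵇ⇒≤ m n (subst T (sym m≤ᵇn) tt) ,_) proj₂) card
  ... | false = HasCard-∅ λ a (m≤n , _) → subst T m≤ᵇn (≤⇒≤ᵇ m≤n)

-- The weight of a vector

0ᵛ : ∀ {d} → Λ d
0ᵛ = replicate _ 0

⊕-comm : ∀ {d} (u v : Λ d) → u ⊕ v ≡ v ⊕ u
⊕-comm = zipWith-comm +-comm

⊕-assoc : ∀ {d} (u v w : Λ d) → (u ⊕ v) ⊕ w ≡ u ⊕ (v ⊕ w)
⊕-assoc = zipWith-assoc +-assoc

⊕-identityʳ : ∀ {d} (u : Λ d) → u ⊕ 0ᵛ ≡ u
⊕-identityʳ = zipWith-identityʳ +-identityʳ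

⊕-right-comm : ∀ {d} (u v w : Λ d) → (u ⊕ v) ⊕ w ≡ (u ⊕ w) ⊕ v
⊕-right-comm u v w = begin
  (u ⊕ v) ⊕ w  ≡⟨ ⊕-assoc u v w ⟩
  u ⊕ (v ⊕ w)  ≡⟨ cong (u ⊕_) (⊕-comm v w) ⟩
  u ⊕ (w ⊕ v)  ≡⟨ ⊕-assoc u w v ⟨
  (u ⊕ w) ⊕ v  ∎

tabulate-0 : ∀ {d} → tabulate {n = d} (λ _ → 0) ≡ 0ᵛ
tabulate-0 {zero} = refl
tabulate-0 {suc d} = cong (0 ∷_) tabulate-0

e-zero : ∀ {d} → e {suc d} Fin.zero ≡ 1 ∷ 0ᵛ
e-zero = cong (1 ∷_) tabulate-0

ne1-suc : ∀ d n → ne1 (suc d) n ≡ n ∷ 0ᵛ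
ne1-suc d n = cong (n ∷_) tabulate-0

e-zero≡ne1 : ∀ {d} → e {suc d} Fin.zero ≡ ne1 (suc d) 1
e-zero≡ne1 = refl

ne1-+ : ∀ d m n → ne1 (suc d) m ⊕ ne1 (suc d) n ≡ ne1 (suc d) (m + n)
ne1-+ d m n = begin
  ne1 (suc d) m ⊕ ne1 (suc d) n  ≡⟨ cong₂ _⊕_ (ne1-suc d m) (ne1-suc d n) ⟩
  (m + n) ∷ (0ᵛ ⊕ 0ᵛ)            ≡⟨ cong ((m + n) ∷_) (⊕-identityʳ 0ᵛ) ⟩
  (m + n) ∷ 0ᵛ                   ≡⟨ ne1-suc d (m + n) ⟨
  ne1 (suc d) (m + n)            ∎

sum-⊕ : ∀ {d} (u v : Λ d) → Vec.sum (u ⊕ v) ≡ Vec.sum u + Vec.sum v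
sum-⊕ [] [] = refl
sum-⊕ (x ∷ u) (y ∷ v) = begin
  (x + y) + Vec.sum (u ⊕ v)            ≡⟨ cong ((x + y) +_) (sum-⊕ u v) ⟩
  (x + y) + (Vec.sum u + Vec.sum v)    ≡⟨ interchange x y _ _ ⟩
  (x + Vec.sum u) + (y + Vec.sum v)    ∎

sum-0ᵛ : ∀ {d} → Vec.sum (0ᵛ {d}) ≡ 0
sum-0ᵛ {zero} = refl
sum-0ᵛ {suc d} = sum-0ᵛ {d}

sum-e : ∀ {d} (t : Fin d) → Vec.sum (e t) ≡ 1
sum-e {suc d} Fin.zero = trans (cong Vec.sum (e-zero {d})) (cong suc (sum-0ᵛ {d}))
sum-e (Fin.suc t) = sum-e t

sum-⊕e : ∀ {d} (v : Λ d) (t : Fin d) → Vec.sum (v ⊕ e t) ≡ suc (Vec.sum v)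
sum-⊕e v t = trans (sum-⊕ v (e t)) (trans (cong (Vec.sum v +_) (sum-e t)) (+-comm (Vec.sum v) 1))

rank : ∀ {d} → Fin d → ℕ
rank t = suc (toℕ t)

-- weight w = Σ_t rank t · w_t
weight : ∀ {d} → Λ d → ℕ
weight [] = 0
weight (x ∷ r) = Vec.sum (x ∷ r) + weight r

weight-⊕ : ∀ {d} (u v : Λ d) → weight (u ⊕ v) ≡ weight u + weight v
weight-⊕ [] [] = refl
weight-⊕ (x ∷ u) (y ∷ v) = begin
  Vec.sum ((x ∷ u) ⊕ (y ∷ v)) + weight (u ⊕ v)
    ≡⟨ cong₂ _+_ (sum-⊕ (x ∷ u) (y ∷ v)) (weight-⊕ u v) ⟩
  (Vec.sum (x ∷ u) + Vec.sum (y ∷ v)) + (weight u + weight v)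
    ≡⟨ interchange (Vec.sum (x ∷ u)) (Vec.sum (y ∷ v)) (weight u) (weight v) ⟩
  (Vec.sum (x ∷ u) + weight u) + (Vec.sum (y ∷ v) + weight v)
    ∎

weight-0ᵛ : ∀ {d} → weight (0ᵛ {d}) ≡ 0
weight-0ᵛ {zero} = refl
weight-0ᵛ {suc d} = cong₂ _+_ (sum-0ᵛ {d}) (weight-0ᵛ {d})

weight-e : ∀ {d} (t : Fin d) → weight (e t) ≡ rank t
weight-e {suc d} Fin.zero = begin
  weight (e {suc d} Fin.zero)               ≡⟨ cong weight (e-zero {d}) ⟩
  suc (Vec.sum (0ᵛ {d})) + weight (0ᵛ {d})  ≡⟨ cong₂ (λ s w → suc s + w) (sum-0ᵛ {d}) (weight-0ᵛ {d}) ⟩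
  1                                         ∎
weight-e (Fin.suc t) = cong₂ _+_ (sum-e t) (weight-e t)

weight-⊕e : ∀ {d} (v : Λ d) (t : Fin d) → weight (v ⊕ e t) ≡ weight v + rank t
weight-⊕e v t = trans (weight-⊕ v (e t)) (cong (weight v +_) (weight-e t))

weight-ne1 : ∀ d n → weight (ne1 (suc d) n) ≡ n
weight-ne1 d n = begin
  weight (ne1 (suc d) n)                    ≡⟨ cong weight (ne1-suc d n) ⟩
  (n + Vec.sum (0ᵛ {d})) + weight (0ᵛ {d})  ≡⟨ cong₂ (λ s w → (n + s) + w) (sum-0ᵛ {d}) (weight-0ᵛ {d}) ⟩
  (n + 0) + 0                               ≡⟨ trans (+-identityʳ (n + 0)) (+-identityʳ n) ⟩
  n                                         ∎

-- Vectors of given weight and partitions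

Decreasing : List ℕ → Set
Decreasing = Linked (λ a b → b ≤ a)

head₀ : List ℕ → ℕ
head₀ [] = 0
head₀ (a ∷ _) = a

head₀-≤ : ∀ {a l} → Decreasing (a ∷ l) → head₀ l ≤ a
head₀-≤ [-] = z≤n
head₀-≤ (b≤a ∷ _) = b≤a

∷-decreasing : ∀ {a l} → head₀ l ≤ a → Decreasing l → Decreasing (a ∷ l)
∷-decreasing {l = []} _ _ = [-]
∷-decreasing {l = b ∷ l} b≤a dec = b≤a ∷ dec

infixr 5 _∷⁺_
_∷⁺_ : ℕ → List ℕ → List ℕ
zero ∷⁺ _ = []
suc s ∷⁺ l = suc s ∷ l

∷⁺-isPartition : ∀ {d m s l} → IsPartition d m l → head₀ l ≤ s → (s ≡ 0 → m ≡ 0) →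
  IsPartition (suc d) (s + m) (s ∷⁺ l)
∷⁺-isPartition {s = zero} _ _ m≡0 = [] , [] , sym (m≡0 refl) , z≤n
∷⁺-isPartition {s = suc s} (pos , dec , sum≡m , len≤d) h≤s _ =
  s≤s z≤n ∷ pos , ∷-decreasing h≤s dec , cong (suc s +_) sum≡m , s≤s len≤d

-- The parts of toPartition w are the nonzero suffix sums w_t + … + w_d: it is
-- the conjugate of the partition having w_t parts equal to t.
toPartition : ∀ {d} → Λ d → List ℕ
toPartition [] = []
toPartition (x ∷ r) = Vec.sum (x ∷ r) ∷⁺ toPartition r

fromPartition : ∀ d → List ℕ → Λ d
fromPartition zero _ = []
fromPartition (suc d) [] = 0 ∷ fromPartition d []
fromPartition (suc d) (a ∷ l) = (a ∸ head₀ l) ∷ fromPartition d l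

head₀-toPartition : ∀ {d} (w : Λ d) → head₀ (toPartition w) ≡ Vec.sum w
head₀-toPartition [] = refl
head₀-toPartition (x ∷ r) with Vec.sum (x ∷ r)
... | zero = refl
... | suc _ = refl

sum≡0⇒weight≡0 : ∀ {d} (w : Λ d) → Vec.sum w ≡ 0 → weight w ≡ 0
sum≡0⇒weight≡0 [] _ = refl
sum≡0⇒weight≡0 (x ∷ r) sum≡0 = cong₂ _+_ sum≡0 (sum≡0⇒weight≡0 r (m+n≡0⇒n≡0 x sum≡0))

sum≡0⇒toPartition≡[] : ∀ {d} (w : Λ d) → Vec.sum w ≡ 0 → toPartition w ≡ []
sum≡0⇒toPartition≡[] [] _ = refl
sum≡0⇒toPartition≡[] (x ∷ r) sum≡0 rewrite sum≡0 = refl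

toPartition-isPartition : ∀ {d} (w : Λ d) → IsPartition d (weight w) (toPartition w)
toPartition-isPartition [] = [] , [] , refl , z≤n
toPartition-isPartition (x ∷ r) = ∷⁺-isPartition (toPartition-isPartition r)
  (subst (_≤ x + Vec.sum r) (sym (head₀-toPartition r)) (m≤n+m (Vec.sum r) x))
  (sum≡0⇒weight≡0 r ∘ m+n≡0⇒n≡0 x)

fromPartition-toPartition : ∀ {d} (w : Λ d) → fromPartition d (toPartition w) ≡ w
fromPartition-toPartition [] = refl
fromPartition-toPartition {suc d} (x ∷ r) with Vec.sum (x ∷ r) in sum≡
... | zero = cong₂ _∷_ (sym (m+n≡0⇒m≡0 x sum≡)) (begin
  fromPartition d []               ≡⟨ cong (fromPartition d) (sum≡0⇒toPartition≡[] r (m+n≡0⇒n≡0 x sum≡)) ⟨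
  fromPartition d (toPartition r)  ≡⟨ fromPartition-toPartition r ⟩
  r                                ∎)
... | suc s = cong₂ _∷_ (begin
  suc s ∸ head₀ (toPartition r)  ≡⟨ cong (suc s ∸_) (head₀-toPartition r) ⟩
  suc s ∸ Vec.sum r              ≡⟨ cong (_∸ Vec.sum r) sum≡ ⟨
  x + Vec.sum r ∸ Vec.sum r      ≡⟨ m+n∸n≡m x (Vec.sum r) ⟩
  x                              ∎) (fromPartition-toPartition r)

sum-fromPartition : ∀ d l → toPartition (fromPartition d l) ≡ l → Vec.sum (fromPartition d l) ≡ head₀ l
sum-fromPartition d l to∘from≡id = trans (sym (head₀-toPartition (fromPartition d l))) (cong head₀ to∘from≡id)

toPartition-fromPartition : ∀ {d l} → All (1 ≤_) l → Decreasing l → length l ≤ d →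
  toPartition (fromPartition d l) ≡ l
toPartition-fromPartition {zero} {[]} _ _ _ = refl
toPartition-fromPartition {suc d} {[]} _ _ _ =
  cong (_∷⁺ toPartition (fromPartition d [])) (sum-fromPartition d [] (toPartition-fromPartition {d} [] [] z≤n))
toPartition-fromPartition {suc d} {suc a ∷ l} (_ ∷ pos) dec (s≤s len≤d) = cong₂ _∷⁺_ (begin
  (suc a ∸ head₀ l) + Vec.sum (fromPartition d l)  ≡⟨ cong (suc a ∸ head₀ l +_) (sum-fromPartition d l ih) ⟩
  (suc a ∸ head₀ l) + head₀ l                      ≡⟨ m∸n+n≡m (head₀-≤ dec) ⟩
  suc a                                            ∎) ih
  where
  ih : toPartition (fromPartition d l) ≡ l
  ih = toPartition-fromPartition pos (Linked.tail dec) len≤d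

weight-card : ∀ {d m N} → HasCard (IsPartition d m) N → HasCard (λ (w : Λ d) → weight w ≡ m) N
weight-card {d} {m} = HasCard-bijection (fromPartition d) toPartition
  weight-from (λ {w} w≡m → subst (λ k → IsPartition d k (toPartition w)) w≡m (toPartition-isPartition w))
  to∘from (λ {w} _ → fromPartition-toPartition w)
  where
  to∘from : ∀ {l} → IsPartition d m l → toPartition (fromPartition d l) ≡ l
  to∘from (pos , dec , _ , len≤d) = toPartition-fromPartition pos dec len≤d
  weight-from : ∀ {l} → IsPartition d m l → weight (fromPartition d l) ≡ m
  weight-from {l} p@(_ , _ , sum≡m , _) with toPartition-isPartition (fromPartition d l)
  ... | _ , _ , sum≡weight , _ = begin
    weight (fromPartition d l)             ≡⟨ sum≡weight ⟨
    sum (toPartition (fromPartition d l))  ≡⟨ cong sum (to∘from p) ⟩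
    sum l                                  ≡⟨ sum≡m ⟩
    m                                      ∎

-- The order ≺ and the weight

multiple<double : ∀ {d x} → d ∣ x → x < d + d → x ≡ 0 ⊎ x ≡ d
multiple<double (divides zero x≡0) _ = inj₁ x≡0
multiple<double {d} (divides (suc zero) x≡d) _ = inj₂ (trans x≡d (+-identityʳ d))
multiple<double {d} (divides (suc (suc q)) refl) x<d+d =
  ⊥-elim (<⇒≱ x<d+d (+-monoʳ-≤ d (m≤m+n d (q * d))))

∣⊖∣-multiple : ∀ {d k s} → 0 < k → k ≤ d → 0 < s → s ≤ d + d →
  d ∣ ∣ k ⊖ s ∣ ⇔ (s ≡ k ⊎ s ≡ k + d)
∣⊖∣-multiple {d} {k} {s} 0<k k≤d 0<s s≤d+d = mk⇔ divisible⇒ ⇒divisible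
  where
  divisible⇒ : d ∣ ∣ k ⊖ s ∣ → s ≡ k ⊎ s ≡ k + d
  divisible⇒ d∣ with k ≤? s
  ... | yes k≤s with multiple<double (subst (d ∣_) (ℤ.∣⊖∣-≤ k≤s) d∣) (<-≤-trans (∸-monoʳ-< 0<k k≤s) s≤d+d)
  ...   | inj₁ s∸k≡0 = inj₁ (trans (sym (m+[n∸m]≡n k≤s)) (trans (cong (k +_) s∸k≡0) (+-identityʳ k)))
  ...   | inj₂ s∸k≡d = inj₂ (trans (sym (m+[n∸m]≡n k≤s)) (cong (k +_) s∸k≡d))
  divisible⇒ d∣ | no k≰s = ⊥-elim (>⇒∤ {{>-nonZero (m<n⇒0<n∸m s<k)}} k∸s<d
    (subst (d ∣_) (trans (ℤ.∣m⊖n∣≡∣n⊖m∣ k s) (ℤ.∣⊖∣-< s<k)) d∣))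
    where
    s<k : s < k
    s<k = ≰⇒> k≰s
    k∸s<d : k ∸ s < d
    k∸s<d = <-≤-trans (∸-monoʳ-< 0<s (<⇒≤ s<k)) k≤d
  ⇒divisible : s ≡ k ⊎ s ≡ k + d → d ∣ ∣ k ⊖ s ∣
  ⇒divisible (inj₁ refl) = subst (λ z → d ∣ ∣ z ∣) (sym (ℤ.n⊖n≡0 k)) (d ∣0)
  ⇒divisible (inj₂ refl) = subst (d ∣_) (sym (trans (ℤ.∣⊖∣-≤ (m≤m+n k d)) (m+n∸m≡n k d))) ∣-refl

[+k-+i]-+j≡k⊖[i+j] : ∀ k i j → (ℤ.+ k ℤ.- ℤ.+ i) ℤ.- ℤ.+ j ≡ k ⊖ (i + j)
[+k-+i]-+j≡k⊖[i+j] k i j = begin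
  (ℤ.+ k ℤ.- ℤ.+ i) ℤ.- ℤ.+ j           ≡⟨ ℤ.+-assoc (ℤ.+ k) (ℤ.- ℤ.+ i) (ℤ.- ℤ.+ j) ⟩
  ℤ.+ k ℤ.+ (ℤ.- ℤ.+ i ℤ.+ ℤ.- ℤ.+ j)   ≡⟨ cong (λ z → (ℤ.+ k) ℤ.+ z) (ℤ.neg-distrib-+ (ℤ.+ i) (ℤ.+ j)) ⟨
  ℤ.+ k ℤ.- ℤ.+ (i + j)                 ≡⟨ ℤ.[+m]-[+n]≡m⊖n k (i + j) ⟩
  k ⊖ (i + j)                           ∎

index-condition : ∀ {d} (i j k : Fin d) →
  ℤ.+ d ℤ.∣ ((idx k ℤ.- idx i) ℤ.- idx j) ⇔ (rank i + rank j ≡ rank k ⊎ rank i + rank j ≡ rank k + d)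
index-condition {d} i j k =
  ∣⊖∣-multiple z<s (toℕ<n k) z<s (+-mono-≤ (toℕ<n i) (toℕ<n j))
    ⇔-∘ mk⇔ (subst (λ z → d ∣ ∣ z ∣) k-i-j≡) (subst (λ z → d ∣ ∣ z ∣) (sym k-i-j≡))
  where
  k-i-j≡ : (idx k ℤ.- idx i) ℤ.- idx j ≡ rank k ⊖ (rank i + rank j)
  k-i-j≡ = [+k-+i]-+j≡k⊖[i+j] (rank k) (rank i) (rank j)

Reach : ∀ d → Λ d → Λ d → Set
Reach d v w = v ≡ w ⊎ Prec d v w

cov⇒reach : ∀ {d} {v w : Λ d} → Cov d v w → Reach d v w
cov⇒reach v⋖w = inj₂ [ v⋖w ]

reach-trans : ∀ {d} {u v w : Λ d} → Reach d u v → Reach d v w → Reach d u w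
reach-trans (inj₁ refl) v→w = v→w
reach-trans (inj₂ u≺v) (inj₁ refl) = inj₂ u≺v
reach-trans (inj₂ u≺v) (inj₂ v≺w) = inj₂ (u≺v Plus.++ v≺w)

weight-balance : ∀ {d} {v w : Λ d} {i j k : Fin d} → (v ⊕ e i) ⊕ e j ≡ w ⊕ e k →
  weight v + (rank i + rank j) ≡ weight w + rank k
weight-balance {v = v} {w} {i} {j} {k} v+ei+ej≡w+ek = begin
  weight v + (rank i + rank j)    ≡⟨ +-assoc (weight v) (rank i) (rank j) ⟨
  weight v + rank i + rank j      ≡⟨ cong (_+ rank j) (weight-⊕e v i) ⟨
  weight (v ⊕ e i) + rank j       ≡⟨ weight-⊕e (v ⊕ e i) j ⟨
  weight ((v ⊕ e i) ⊕ e j)        ≡⟨ cong weight v+ei+ej≡w+ek ⟩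
  weight (w ⊕ e k)                ≡⟨ weight-⊕e w k ⟩
  weight w + rank k               ∎

cov⇒weight : ∀ {d} {v w : Λ d} → Cov d v w → ∃ λ a → weight v + a * d ≡ weight w
cov⇒weight {d} {v} {w} (i , j , k , d∣ , eq) with to (index-condition i j k) d∣
... | inj₁ i+j≡k = 0 , +-cancelʳ-≡ (rank k) _ _ (begin
  (weight v + 0 * d) + rank k   ≡⟨ cong (_+ rank k) (+-identityʳ (weight v)) ⟩
  weight v + rank k             ≡⟨ cong (weight v +_) i+j≡k ⟨
  weight v + (rank i + rank j)  ≡⟨ weight-balance eq ⟩
  weight w + rank k             ∎)
... | inj₂ i+j≡k+d = 1 , +-cancelʳ-≡ (rank k) _ _ (begin
  (weight v + 1 * d) + rank k   ≡⟨ cong (λ x → weight v + x + rank k) (*-identityˡ d) ⟩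
  (weight v + d) + rank k       ≡⟨ +-assoc (weight v) d (rank k) ⟩
  weight v + (d + rank k)       ≡⟨ cong (weight v +_) (trans (+-comm d (rank k)) (sym i+j≡k+d)) ⟩
  weight v + (rank i + rank j)  ≡⟨ weight-balance eq ⟩
  weight w + rank k             ∎)

prec⇒weight : ∀ {d} {v w : Λ d} → Prec d v w → ∃ λ a → weight v + a * d ≡ weight w
prec⇒weight [ v⋖w ] = cov⇒weight v⋖w
prec⇒weight {d} {v} {w} (_∷_ {y = u} v⋖u u≺w) with cov⇒weight v⋖u | prec⇒weight u≺w
... | a , va≡u | b , ub≡w = a + b , (begin
  weight v + (a + b) * d      ≡⟨ cong (weight v +_) (*-distribʳ-+ d a b) ⟩
  weight v + (a * d + b * d)  ≡⟨ +-assoc (weight v) (a * d) (b * d) ⟨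
  weight v + a * d + b * d    ≡⟨ cong (_+ b * d) va≡u ⟩
  weight u + b * d            ≡⟨ ub≡w ⟩
  weight w                    ∎)

reach⇒weight : ∀ {d} {v w : Λ d} → Reach d v w → ∃ λ a → weight v + a * d ≡ weight w
reach⇒weight (inj₁ refl) = 0 , +-identityʳ _
reach⇒weight (inj₂ v≺w) = prec⇒weight v≺w

cov-⊕ʳ : ∀ {d} {v w : Λ d} (u : Λ d) → Cov d v w → Cov d (v ⊕ u) (w ⊕ u)
cov-⊕ʳ {v = v} {w} u (i , j , k , d∣ , v+ei+ej≡w+ek) = i , j , k , d∣ , (begin
  ((v ⊕ u) ⊕ e i) ⊕ e j  ≡⟨ cong (_⊕ e j) (⊕-right-comm v u (e i)) ⟩
  ((v ⊕ e i) ⊕ u) ⊕ e j  ≡⟨ ⊕-right-comm (v ⊕ e i) u (e j) ⟩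
  ((v ⊕ e i) ⊕ e j) ⊕ u  ≡⟨ cong (_⊕ u) v+ei+ej≡w+ek ⟩
  (w ⊕ e k) ⊕ u          ≡⟨ ⊕-right-comm w (e k) u ⟩
  (w ⊕ u) ⊕ e k          ∎)

prec-⊕ʳ : ∀ {d} {v w : Λ d} (u : Λ d) → Prec d v w → Prec d (v ⊕ u) (w ⊕ u)
prec-⊕ʳ u [ v⋖w ] = [ cov-⊕ʳ u v⋖w ]
prec-⊕ʳ u (v⋖x ∷ x≺w) = cov-⊕ʳ u v⋖x ∷ prec-⊕ʳ u x≺w

reach-⊕ʳ : ∀ {d} {v w : Λ d} (u : Λ d) → Reach d v w → Reach d (v ⊕ u) (w ⊕ u)
reach-⊕ʳ u (inj₁ refl) = inj₁ refl
reach-⊕ʳ u (inj₂ v≺w) = inj₂ (prec-⊕ʳ u v≺w)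

reach-⊕ : ∀ {d} {v v′ w w′ : Λ d} → Reach d v v′ → Reach d w w′ → Reach d (v ⊕ w) (v′ ⊕ w′)
reach-⊕ {d} {v} {v′} {w} {w′} v→v′ w→w′ = reach-trans (reach-⊕ʳ w v→v′)
  (subst₂ (Reach d) (⊕-comm w v′) (⊕-comm w′ v′) (reach-⊕ʳ v′ w→w′))

rank-inject₁ : ∀ {d} (t : Fin d) → rank (inject₁ t) + 1 ≡ rank (Fin.suc t)
rank-inject₁ t = trans (cong (λ x → suc x + 1) (toℕ-inject₁ t)) (+-comm (rank t) 1)

rank-fromℕ : ∀ d → rank (fromℕ d) ≡ suc d
rank-fromℕ d = cong suc (toℕ-fromℕ d)

cov-split : ∀ {d} (t : Fin d) → Cov (suc d) (e (Fin.suc t)) (e (inject₁ t) ⊕ e Fin.zero)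
cov-split t = inject₁ t , Fin.zero , Fin.suc t ,
  from (index-condition (inject₁ t) Fin.zero (Fin.suc t)) (inj₁ (rank-inject₁ t)) ,
  trans (⊕-assoc (e (Fin.suc t)) (e (inject₁ t)) (e Fin.zero)) (⊕-comm (e (Fin.suc t)) _)

cov-carry : ∀ {d} (v : Λ (suc d)) → Cov (suc d) v (v ⊕ e (fromℕ d))
cov-carry {d} v = last , last , last ,
  from (index-condition last last last) (inj₂ (cong (rank last +_) (rank-fromℕ d))) , refl
  where
  last : Fin (suc d)
  last = fromℕ d

reach-e : ∀ {d} (t : Fin (suc d)) → Reach (suc d) (e t) (ne1 (suc d) (rank t))
reach-e {d} = <-weakInduction (λ t → Reach (suc d) (e t) (ne1 (suc d) (rank t)))
  (inj₁ e-zero≡ne1)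
  (λ t e-inject₁→ne1 → reach-trans (cov⇒reach (cov-split t))
    (subst (Reach (suc d) _) (trans (ne1-+ d (rank (inject₁ t)) 1) (cong (ne1 (suc d)) (rank-inject₁ t)))
      (reach-⊕ e-inject₁→ne1 (inj₁ e-zero≡ne1))))

zero-or-⊕e : ∀ {d} (w : Λ d) → w ≡ 0ᵛ ⊎ ∃₂ λ w′ t → w ≡ w′ ⊕ e t
zero-or-⊕e [] = inj₁ refl
zero-or-⊕e (suc x ∷ r) = inj₂ (x ∷ r , Fin.zero , sym (begin
  (x ∷ r) ⊕ e Fin.zero  ≡⟨ cong ((x ∷ r) ⊕_) e-zero ⟩
  (x + 1) ∷ (r ⊕ 0ᵛ)   ≡⟨ cong₂ _∷_ (+-comm x 1) (⊕-identityʳ r) ⟩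
  suc x ∷ r            ∎))
zero-or-⊕e (zero ∷ r) with zero-or-⊕e r
... | inj₁ refl = inj₁ refl
... | inj₂ (r′ , t , refl) = inj₂ (0 ∷ r′ , Fin.suc t , refl)

reach-ne1 : ∀ {d} (w : Λ (suc d)) → Reach (suc d) w (ne1 (suc d) (weight w))
reach-ne1 {d} w = by-size (Vec.sum w) w refl
  where
  by-size : ∀ k (w : Λ (suc d)) → Vec.sum w ≡ k → Reach (suc d) w (ne1 (suc d) (weight w))
  by-size k w sum≡k with zero-or-⊕e w
  ... | inj₁ refl = inj₁ (sym (trans (cong (ne1 (suc d)) (weight-0ᵛ {suc d})) (ne1-suc d 0)))
  ... | inj₂ (w′ , t , refl) with k
  ...   | zero = ⊥-elim (1+n≢0 (trans (sym (sum-⊕e w′ t)) sum≡k))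
  ...   | suc k = subst (Reach (suc d) (w′ ⊕ e t)) ne1-weight
          (reach-⊕ (by-size k w′ (suc-injective (trans (sym (sum-⊕e w′ t)) sum≡k))) (reach-e t))
    where
    ne1-weight : ne1 (suc d) (weight w′) ⊕ ne1 (suc d) (rank t) ≡ ne1 (suc d) (weight (w′ ⊕ e t))
    ne1-weight = trans (ne1-+ d (weight w′) (rank t)) (cong (ne1 (suc d)) (sym (weight-⊕e w′ t)))

reach-ne1-+ : ∀ {d} a (w : Λ (suc d)) → Reach (suc d) w (ne1 (suc d) (weight w + a * suc d))
reach-ne1-+ zero w = subst (Reach _ w ∘ ne1 _) (sym (+-identityʳ (weight w))) (reach-ne1 w)
reach-ne1-+ {d} (suc a) w = reach-trans (cov⇒reach (cov-carry w))
  (subst (Reach (suc d) (w ⊕ e (fromℕ d)) ∘ ne1 (suc d)) carried (reach-ne1-+ a (w ⊕ e (fromℕ d))))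
  where
  carried : weight (w ⊕ e (fromℕ d)) + a * suc d ≡ weight w + suc a * suc d
  carried = begin
    weight (w ⊕ e (fromℕ d)) + a * suc d  ≡⟨ cong (_+ a * suc d) (weight-⊕e w (fromℕ d)) ⟩
    weight w + rank (fromℕ d) + a * suc d ≡⟨ cong (λ r → weight w + r + a * suc d) (rank-fromℕ d) ⟩
    weight w + suc d + a * suc d          ≡⟨ +-assoc (weight w) (suc d) (a * suc d) ⟩
    weight w + suc a * suc d              ∎

inC⇔weight : ∀ {d n} (w : Λ (suc d)) → InC (suc d) n w ⇔ (∃ λ a → weight w + a * suc d ≡ n)
inC⇔weight {d} {n} w = mk⇔
  (λ w→ne1 → let a , eq = reach⇒weight w→ne1 in a , trans eq (weight-ne1 d n))
  (λ (a , eq) → subst (Reach (suc d) w ∘ ne1 (suc d)) eq (reach-ne1-+ a w))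

+-multiple⇔ : ∀ {d x n} .{{_ : NonZero d}} → (∃ λ a → x + a * d ≡ n) ⇔
  (∃ λ a → a ∈ upTo (suc n) × a * d ≤ n × x ≡ n ∸ a * d)
+-multiple⇔ {d} {x} {n} = mk⇔
  (λ (a , x+ad≡n) → let ad≤n = subst (a * d ≤_) x+ad≡n (m≤n+m (a * d) x) in
    a , ∈-upTo⁺ (s≤s (≤-trans (m≤m*n a d) ad≤n)) , ad≤n ,
    sym (trans (cong (_∸ a * d) (sym x+ad≡n)) (m+n∸n≡m x (a * d))))
  (λ (a , _ , ad≤n , x≡) → a , trans (cong (_+ a * d) x≡) (m∸n+n≡m ad≤n))

theorem7p1 : (d n : ℕ) → 1 ≤ d → (P : ℕ → ℕ) →
    (∀ m → HasCard (IsPartition d m) (P m)) →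
    HasCard (InC d n) (partSum d n P)
theorem7p1 (suc d) n _ P partitions =
  HasCard-cong (λ w → ⇔-sym (+-multiple⇔ ⇔-∘ inC⇔weight w))
    (HasCard-⋃ {Q = Level} (λ i → HasCard-when (weight-card (partitions (n ∸ i * suc d))))
      same-level (upTo⁺ (suc n)))
  where
  Level : ℕ → Λ (suc d) → Set
  Level i w = i * suc d ≤ n × weight w ≡ n ∸ i * suc d
  same-level : ∀ w {i j} → Level i w → Level j w → i ≡ j
  same-level w {i} {j} (id≤n , w≡n∸id) (jd≤n , w≡n∸jd) = *-cancelʳ-≡ i j (suc d) (begin
    i * suc d              ≡⟨ m∸[m∸n]≡n id≤n ⟨
    n ∸ (n ∸ i * suc d)    ≡⟨ cong (n ∸_) (trans (sym w≡n∸id) w≡n∸jd) ⟩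
    n ∸ (n ∸ j * suc d)    ≡⟨ m∸[m∸n]≡n jd≤n ⟩
    j * suc d              ∎)
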